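{- Let $p,q$ be positive integers. The componentwise map $(\tau_1,\dots,\tau_{p+q})\mapsto(\tau_1^+,\dots,\tau_{p+q}^+)$ maps $\mathcal{F}^{(B)}_{(p,q)}$ onto $\mathcal{F}^{+}_{(p,q)}$, and every element of $\mathcal{F}^{+}_{(p,q)}$ has exactly two preimages under this map.
   Context: $B_n$ is the group of signed permutations of $\{\pm1,\dots,\pm n\}$ ($\sigma(-i)=-\sigma(i)$). Write $[a_1\dots a_k]=(a_1\dots a_k~-a_1\dots-a_k)$ and $((a_1\dots a_k))=(a_1\dots a_k)(-a_1\dots-a_k)$. Type $B$ transpositions are $[i]=(i~-i)$ and $((i~j))$ with $|i|\ne|j|$. For $\sigma\in B_n$, define $\sigma^+\in B_n$ by $\sigma^+(i)=|\sigma(i)|$ if $i>0$ and $\sigma^+(i)=-|\sigma(i)|$ if $i<0$, and $|\sigma|\in\mathcal{S}_n$ by $|\sigma|(i)=|\sigma(i)|$ for $1\le i\le n$. Let $\gamma_{p,q}=[1~2\dots p][p+1\dots p+q]$ and $\beta_{p,q}=((1~2\dots p))((p+1\dots p+q))$ in $B_{p+q}$. $\mathcal{F}^{(B)}_{(p,q)}$ is the set of $(p+q)$-tuples $(\tau_1,\dots,\tau_{p+q})$ of type $B$ transpositions in $B_{p+q}$ with $\tau_1\cdots\tau_{p+q}=\gamma_{p,q}$ and $\{|\tau_1|,\dots,|\tau_{p+q}|\}$ generating $\mathcal{S}_{p+q}$. $\mathcal{F}^{+}_{(p,q)}$ is the set of $(p+q)$-tuples $(\sigma_1,\dots,\sigma_{p+q})$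 of type $B$ transpositions in $B_{p+q}$ with $\sigma_1\cdots\sigma_{p+q}=\beta_{p,q}$, $\{|\sigma_1|,\dots,|\sigma_{p+q}|\}$ generating $\mathcal{S}_{p+q}$, and $\sigma_i=\sigma_i^+$ for all $i$. -}

module Defs where

open import Data.Nat using (ℕ; zero; suc; _+_; _<_; _<?_)
open import Data.Fin using (Fin; toℕ; fromℕ<; _≟_)
open import Data.Bool using (Bool; true; false; _xor_; if_then_else_)
open import Data.Vec using (Vec; []; _∷_; lookup; tabulate; map)
open import Data.Vec.Membership.Propositional using (_∈_)
import Data.Vec.Relation.Unary.All
open import Data.Product using (_×_; _,_; proj₁; proj₂; Σ; ∃)
open import Data.Sum using (_⊎_)
open import Relation.Nullary using (¬_; yes; no)
open import Relation.Nullary.Decidable using (⌊_⌋)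
open import Relation.Binary.PropositionalEquality using (_≡_)

-- Signed elements of {±1,…,±n}: (i , s) stands for  i+1  if s = false
-- and  -(i+1)  if s = true  (positions 0-indexed via Fin n).

SEl : ℕ → Set
SEl n = Fin n × Bool

neg : ∀ {n} → SEl n → SEl n
neg (i , s) = (i , Data.Bool.not s)

-- A signed permutation σ ∈ B_n is stored by its values on the positive
-- elements 1,…,n; the negative ones are determined by σ(-i) = -σ(i).
SPerm : ℕ → Set
SPerm n = Vec (SEl n) n

apply : ∀ {n} → SPerm n → SEl n → SEl n
apply σ (i , s) with lookup σ i
... | (j , t) = (j , t xor s)

Perm : ℕ → Set
Perm n = Vec (Fin n) n

IsPerm : ∀ {n} → Perm n → Set
IsPerm {n} π = ∀ (i j : Fin n) → lookup π i ≡ lookup π j → i ≡ j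

-- composition (σ ∘ τ)(x) = σ(τ(x))
_∘B_ : ∀ {n} → SPerm n → SPerm n → SPerm n
σ ∘B τ = tabulate (λ i → apply σ (lookup τ i))

idB : ∀ {n} → SPerm n
idB = tabulate (λ i → (i , false))

_∘S_ : ∀ {n} → Perm n → Perm n → Perm n
π ∘S ρ = tabulate (λ i → lookup π (lookup ρ i))

idS : ∀ {n} → Perm n
idS = tabulate (λ i → i)

plus : ∀ {n} → SPerm n → SPerm n
plus σ = map (λ x → (proj₁ x , false)) σ

absP : ∀ {n} → SPerm n → Perm n
absP σ = map proj₁ σ

-- [i] = (i  -i)
bar : ∀ {n} → Fin n → SPerm n
bar i = tabulate (λ k → (k , ⌊ k ≟ i ⌋))

-- ((a b)) = (a b)(-a -b), for |a| ≠ |b|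
dswap : ∀ {n} → SEl n → SEl n → SPerm n
dswap (i , s) (j , t) =
  tabulate (λ k → if ⌊ k ≟ i ⌋ then (j , t xor s)
                  else (if ⌊ k ≟ j ⌋ then (i , s xor t) else (k , false)))

IsBTransposition : ∀ {n} → SPerm n → Set
IsBTransposition {n} σ =
  (Σ (Fin n) λ i → σ ≡ bar i)
  ⊎ (Σ (SEl n) λ a → Σ (SEl n) λ b → ¬ (proj₁ a ≡ proj₁ b) × σ ≡ dswap a b)

prodB : ∀ {n k} → Vec (SPerm n) k → SPerm n
prodB []       = idB
prodB (τ ∷ τs) = τ ∘B prodB τs

data InGen {n k : ℕ} (gs : Vec (Perm n) k) : Perm n → Set where
  gen-gen : ∀ {g} → g ∈ gs → InGen gs g
  gen-id  : InGen gs idS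
  gen-mul : ∀ {π ρ} → InGen gs π → InGen gs ρ → InGen gs (π ∘S ρ)
  gen-inv : ∀ {π ρ} → InGen gs π → π ∘S ρ ≡ idS → InGen gs ρ

Generates : ∀ {n k} → Vec (Perm n) k → Set
Generates {n} gs = ∀ (π : Perm n) → IsPerm π → InGen gs π

-- turn a natural number into an element of Fin n, with a fallback
-- (only ever used with values that are < n)
toFinOr : ∀ {n} → ℕ → Fin n → Fin n
toFinOr {n} m d with m <? n
... | yes m<n = fromℕ< m<n
... | no  _   = d

-- successor map of the cycle on block {start,…,start+len-1} (0-indexed);
-- the last element goes to the first one with sign `wrap`.
blockNext : ∀ {n} → Bool → ℕ → ℕ → Fin n → SEl n
blockNext wrap start len k =
  if ⌊ suc (toℕ k) <? start + len ⌋
  then (toFinOr (suc (toℕ k)) k , false)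
  else (toFinOr start k , wrap)

twoCycles : Bool → (p q : ℕ) → SPerm (p + q)
twoCycles wrap p q =
  tabulate (λ k → if ⌊ toℕ k <? p ⌋ then blockNext wrap 0 p k
                                     else blockNext wrap p q k)

-- γ_{p,q} = [1 … p][p+1 … p+q]
gammaPQ : (p q : ℕ) → SPerm (p + q)
gammaPQ = twoCycles true

-- β_{p,q} = ((1 … p))((p+1 … p+q))
betaPQ : (p q : ℕ) → SPerm (p + q)
betaPQ = twoCycles false

FB : (p q : ℕ) → Vec (SPerm (p + q)) (p + q) → Set
FB p q τs =
  Data.Vec.Relation.Unary.All.All IsBTransposition τs
  × prodB τs ≡ gammaPQ p q
  × Generates (map absP τs)

F+ : (p q : ℕ) → Vec (SPerm (p + q)) (p + q) → Set
F+ p q σs =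
  Data.Vec.Relation.Unary.All.All IsBTransposition σs
  × prodB σs ≡ betaPQ p q
  × Generates (map absP σs)
  × Data.Vec.Relation.Unary.All.All (λ σ → σ ≡ plus σ) σs

plusAll : ∀ {n k} → Vec (SPerm n) k → Vec (SPerm n) k
plusAll = map plus

-- Signs are computed in 𝔽₂ (Bool with xor and ∧).  The sign of a product
-- τ₁ ⋯ τ_N at x is the sum over i of the sign of τ_i at the point reached by the
-- suffix τ_{i+1} ⋯ τ_N.  Following the points moved by τ_i back through that
-- suffix gives the trajectory graph (one edge per factor, a loop for a bar [c]).
-- If the |τ_i| generate S_N it is connected; having N edges on N vertices it then
-- has at most one loop, and its mod-2 boundary equation ∂ u = r has exactly two
-- solutions whenever r has even weight (both facts by edge contraction).
-- Bars are the only factors with an odd number of sign changes and the signs of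
-- γ_{p,q} have even weight, so a factorization of γ has no bar: this is (i).
-- Lifting a positive factorization of β = γ⁺ to one of γ amounts to choosing a
-- sign u_i on each factor with ∂ u = (signs of γ): this is (ii).
module Submission where

open import Defs

open import Algebra.Bundles using (CommutativeRing)
open import Data.Bool using (Bool; true; false; not; _∧_; _xor_; if_then_else_) renaming (_≟_ to _≟B_)
open import Data.Bool.Properties
  using (xor-∧-commutativeRing; xor-assoc; xor-comm; xor-same; xor-identityʳ; not-involutive; ¬-not;
         ∧-comm; ∧-identityʳ; ∧-zeroʳ; ∧-distribˡ-xor; ∧-distribʳ-xor; if-float; if-cong₂; if-eta)
open import Data.Empty using (⊥-elim)
open import Data.Fin using (Fin; zero; suc; toℕ; fromℕ; fromℕ<; punchIn; punchOut) renaming (_≟_ to _≟F_)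
open import Data.Fin.Permutation using (permutation)
open import Data.Fin.Properties
  using (any?; punchInᵢ≢i; punchIn-punchOut; punchOut-punchIn; punchOut-cong; punchOut-injective;
         toℕ-injective; toℕ<n; toℕ-fromℕ; toℕ-fromℕ<)
open import Data.Nat using (ℕ; zero; suc; _+_; _≤_; _<_; _<?_; _≥_; s≤s; z≤n)
open import Data.Nat.Properties using (1+n≰n; ≤-antisym; ≤-pred; <⇒≢; ≮⇒≥; <-≤-trans; m≤m+n; m<m+n; n<1+n)
open import Data.Product using (_×_; _,_; Σ; proj₁; proj₂)
open import Data.Sum using (_⊎_; inj₁; inj₂)
import Data.Sum
open import Data.Vec using (Vec; []; _∷_; lookup; tabulate; map)
open import Data.Vec.Functional using (insertAt)
open import Data.Vec.Functional.Properties using (insertAt-lookup; insertAt-punchIn)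
open import Data.Vec.Membership.Propositional using (_∈_)
open import Data.Vec.Properties using (lookup∘tabulate; lookup-map; map-∘; map-cong; tabulate-cong)
open import Data.Vec.Relation.Binary.Pointwise.Extensional using (ext; Pointwise-≡⇒≡)
open import Data.Vec.Relation.Unary.All using (All)
import Data.Vec.Relation.Unary.All as All
open import Data.Vec.Relation.Unary.All.Properties using (lookup⁺; lookup⁻; map⁺)
open import Function using (_∘_)
open import Relation.Nullary using (¬_; Dec; yes; no; ¬?)
open import Relation.Nullary.Decidable using (⌊_⌋; decidable-stable)
open import Relation.Binary.PropositionalEquality
  using (_≡_; _≢_; _≗_; refl; sym; trans; cong; cong₂; subst; module ≡-Reasoning)

open import Algebra.Properties.Semiring.Sum (CommutativeRing.semiring xor-∧-commutativeRing)
  using (sum; sum-cong-≗; sum-remove; ∑-distrib-+; ∑-comm; *-distribˡ-sum; sum-replicate-zero; ∑-permute)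

open ≡-Reasoning

-- Kronecker delta on Fin n, with values in Bool read as the field 𝔽₂
-- (_xor_ is addition, _∧_ is multiplication).
δ : ∀ {n} → Fin n → Fin n → Bool
δ a b = ⌊ a ≟F b ⌋

δ-refl : ∀ {n} (a : Fin n) → δ a a ≡ true
δ-refl a with a ≟F a
... | yes _   = refl
... | no a≢a = ⊥-elim (a≢a refl)

δ-≢ : ∀ {n} {a b : Fin n} → a ≢ b → δ a b ≡ false
δ-≢ {a = a} {b} a≢b with a ≟F b
... | yes a≡b = ⊥-elim (a≢b a≡b)
... | no _    = refl

δ-sym : ∀ {n} (a b : Fin n) → δ a b ≡ δ b a
δ-sym a b with a ≟F b
... | yes refl = sym (δ-refl a)
... | no a≢b   = sym (δ-≢ (a≢b ∘ sym))

xor-cancelʳ : ∀ a b → (a xor b) xor b ≡ a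
xor-cancelʳ a b = trans (xor-assoc a b b) (trans (cong (a xor_) (xor-same b)) (xor-identityʳ a))

sum-δ : ∀ {k} (a : Fin k) (g : Fin k → Bool) → sum (λ i → δ i a ∧ g i) ≡ g a
sum-δ {suc k} a g = begin
  sum (λ i → δ i a ∧ g i)
    ≡⟨ sum-remove {i = a} (λ i → δ i a ∧ g i) ⟩
  (δ a a ∧ g a) xor sum (λ i → δ (punchIn a i) a ∧ g (punchIn a i))
    ≡⟨ cong₂ _xor_ (cong (_∧ g a) (δ-refl a)) others-vanish ⟩
  g a xor false
    ≡⟨ xor-identityʳ (g a) ⟩
  g a ∎
  where
  others-vanish : sum (λ i → δ (punchIn a i) a ∧ g (punchIn a i)) ≡ false
  others-vanish = trans (sum-cong-≗ (λ i → cong (_∧ g (punchIn a i)) (δ-≢ (punchInᵢ≢i a i))))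
                        (sum-replicate-zero k)

sum-δ-one : ∀ {k} (a : Fin k) → sum (λ i → δ i a) ≡ true
sum-δ-one a = trans (sum-cong-≗ (λ i → sym (∧-identityʳ (δ i a)))) (sum-δ a (λ _ → true))

sum-true⇒nonzero : ∀ {k} (g : Fin k → Bool) → sum g ≡ true → Σ (Fin k) λ i → g i ≡ true
sum-true⇒nonzero {zero} g ()
sum-true⇒nonzero {suc k} g s with g zero in g0
... | true  = zero , g0
... | false = let (i , gi) = sum-true⇒nonzero (g ∘ suc) s in suc i , gi

sum-reindex : ∀ {n} (f g : Fin n → Fin n) → (∀ y → f (g y) ≡ y) → (∀ x → g (f x) ≡ x) →
              (h : Fin n → Bool) → sum (h ∘ f) ≡ sum h
sum-reindex f g fg gf h = sym (∑-permute h (permutation f g fg gf))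

Edge : ℕ → Set
Edge n = Fin n × Fin n

Graph : ℕ → ℕ → Set
Graph k n = Fin k → Edge n

mapEdge : ∀ {m n} → (Fin m → Fin n) → Edge m → Edge n
mapEdge f (a , b) = f a , f b

IsLoop : ∀ {n} → Edge n → Set
IsLoop e = proj₁ e ≡ proj₂ e

-- The incidence vector of an edge over 𝔽₂; a loop is incident to no vertex.
incident : ∀ {n} → Edge n → Fin n → Bool
incident (a , b) z = δ z a xor δ z b

∂ : ∀ {k n} → Graph k n → (Fin k → Bool) → Fin n → Bool
∂ E u z = sum (λ i → u i ∧ incident (E i) z)

∂-cong : ∀ {k n} (E : Graph k n) {u v : Fin k → Bool} → u ≗ v → ∂ E u ≗ ∂ E v
∂-cong E u≗v z = sum-cong-≗ (λ i → cong (_∧ incident (E i) z) (u≗v i))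

∂-xor : ∀ {k n} (E : Graph k n) (u v : Fin k → Bool) →
        ∂ E (λ i → u i xor v i) ≗ λ z → ∂ E u z xor ∂ E v z
∂-xor E u v z = trans (sum-cong-≗ (λ i → ∧-distribʳ-xor (incident (E i) z) (u i) (v i)))
                      (∑-distrib-+ (λ i → u i ∧ incident (E i) z) (λ i → v i ∧ incident (E i) z))

Separates : ∀ {n} → (Fin n → Bool) → Edge n → Set
Separates S e = S (proj₁ e) ≢ S (proj₂ e)

Connected : ∀ {k n} → Graph k n → Set
Connected {k} {n} E =
  ∀ (S : Fin n → Bool) x y → S x ≢ S y → Σ (Fin k) λ i → Separates S (E i)

-- A loop never separates, so deleting one keeps the graph connected.
connected-dropLoop : ∀ {k n} (E : Graph (suc k) n) i → IsLoop (E i) → Connected E →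
                     Connected (E ∘ punchIn i)
connected-dropLoop E i loop conn S x y Sx≢Sy with conn S x y Sx≢Sy
... | j , sep with i ≟F j
...   | yes refl = ⊥-elim (sep (cong S loop))
...   | no i≢j   = punchOut i≢j , subst (Separates S ∘ E) (sym (punchIn-punchOut i≢j)) sep

push : ∀ {m n} → (Fin m → Fin n) → (Fin m → Bool) → Fin n → Bool
push f g z = sum (λ w → δ (f w) z ∧ g w)

push-zero : ∀ {m n} (f : Fin m → Fin n) → push f (λ _ → false) ≗ λ _ → false
push-zero {m} f z = trans (sum-cong-≗ (λ w → ∧-zeroʳ (δ (f w) z))) (sum-replicate-zero m)

push-total : ∀ {m n} (f : Fin m → Fin n) (g : Fin m → Bool) → sum (push f g) ≡ sum g
push-total f g = begin
  sum (λ z → sum (λ w → δ (f w) z ∧ g w)) ≡⟨ ∑-comm (λ z w → δ (f w) z ∧ g w) ⟩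
  sum (λ w → sum (λ z → δ (f w) z ∧ g w)) ≡⟨ sum-cong-≗ each-fibre ⟩
  sum g                                   ∎
  where
  each-fibre : ∀ w → sum (λ z → δ (f w) z ∧ g w) ≡ g w
  each-fibre w = begin
    sum (λ z → δ (f w) z ∧ g w) ≡⟨ sum-cong-≗ (λ z → trans (∧-comm (δ (f w) z) (g w))
                                                            (cong (g w ∧_) (δ-sym (f w) z))) ⟩
    sum (λ z → g w ∧ δ z (f w)) ≡⟨ *-distribˡ-sum (g w) (λ z → δ z (f w)) ⟨
    g w ∧ sum (λ z → δ z (f w)) ≡⟨ cong (g w ∧_) (sum-δ-one (f w)) ⟩
    g w ∧ true                  ≡⟨ ∧-identityʳ (g w) ⟩
    g w                         ∎

push-incident : ∀ {m n} (f : Fin m → Fin n) (e : Edge m) → push f (incident e) ≗ incident (mapEdge f e)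
push-incident f (a , b) z = begin
  sum (λ w → δ (f w) z ∧ (δ w a xor δ w b))
    ≡⟨ sum-cong-≗ (λ w → trans (∧-distribˡ-xor (δ (f w) z) (δ w a) (δ w b))
                              (cong₂ _xor_ (∧-comm (δ (f w) z) (δ w a)) (∧-comm (δ (f w) z) (δ w b)))) ⟩
  sum (λ w → (δ w a ∧ δ (f w) z) xor (δ w b ∧ δ (f w) z))
    ≡⟨ ∑-distrib-+ (λ w → δ w a ∧ δ (f w) z) (λ w → δ w b ∧ δ (f w) z) ⟩
  sum (λ w → δ w a ∧ δ (f w) z) xor sum (λ w → δ w b ∧ δ (f w) z)
    ≡⟨ cong₂ _xor_ (trans (sum-δ a (λ w → δ (f w) z)) (δ-sym (f a) z))
                   (trans (sum-δ b (λ w → δ (f w) z)) (δ-sym (f b) z)) ⟩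
  δ z (f a) xor δ z (f b) ∎

push-∂ : ∀ {k m n} (f : Fin m → Fin n) (E : Graph k m) (u : Fin k → Bool) →
         push f (∂ E u) ≗ ∂ (mapEdge f ∘ E) u
push-∂ f E u z = begin
  sum (λ w → δ (f w) z ∧ sum (λ i → u i ∧ incident (E i) w))
    ≡⟨ sum-cong-≗ (λ w → *-distribˡ-sum (δ (f w) z) (λ i → u i ∧ incident (E i) w)) ⟩
  sum (λ w → sum (λ i → δ (f w) z ∧ (u i ∧ incident (E i) w)))
    ≡⟨ ∑-comm (λ w i → δ (f w) z ∧ (u i ∧ incident (E i) w)) ⟩
  sum (λ i → sum (λ w → δ (f w) z ∧ (u i ∧ incident (E i) w)))
    ≡⟨ sum-cong-≗ (λ i → trans (sum-cong-≗ (λ w → ∧-swap (δ (f w) z) (u i) (incident (E i) w)))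
                               (sym (*-distribˡ-sum (u i) (λ w → δ (f w) z ∧ incident (E i) w)))) ⟩
  sum (λ i → u i ∧ push f (incident (E i)) z)
    ≡⟨ sum-cong-≗ (λ i → cong (u i ∧_) (push-incident f (E i) z)) ⟩
  ∂ (mapEdge f ∘ E) u z ∎
  where
  ∧-swap : ∀ a b c → a ∧ (b ∧ c) ≡ b ∧ (a ∧ c)
  ∧-swap true  b c = refl
  ∧-swap false b c = sym (∧-zeroʳ b)

≗-split : ∀ {k} {A : Set} {g h : Fin (suc k) → A} (j : Fin (suc k)) →
          g j ≡ h j → g ∘ punchIn j ≗ h ∘ punchIn j → g ≗ h
≗-split {g = g} {h} j gj≡hj rest i with j ≟F i
... | yes refl = gj≡hj
... | no j≢i   = subst (λ i → g i ≡ h i) (punchIn-punchOut j≢i) (rest (punchOut j≢i))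

-- Identifying vertex y with vertex x ≢ y; the other vertices keep their order.
module Merge {m} (x y : Fin (suc (suc m))) (x≢y : x ≢ y) where

  y≢x : y ≢ x
  y≢x = x≢y ∘ sym

  merge : Fin (suc (suc m)) → Fin (suc m)
  merge w with y ≟F w
  ... | yes _   = punchOut y≢x
  ... | no y≢w = punchOut y≢w

  merge-y : merge y ≡ merge x
  merge-y with y ≟F y | y ≟F x
  ... | yes _  | no _    = punchOut-cong y refl
  ... | yes _  | yes y≡x = ⊥-elim (y≢x y≡x)
  ... | no y≢y | _       = ⊥-elim (y≢y refl)

  merge-punchIn : ∀ z → merge (punchIn y z) ≡ z
  merge-punchIn z with y ≟F punchIn y z
  ... | yes y≡yz = ⊥-elim (punchInᵢ≢i y z (sym y≡yz))
  ... | no _     = trans (punchOut-cong y refl) (punchOut-punchIn y)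

  merge-fibre : ∀ w v → merge w ≡ merge v → w ≡ v ⊎ (w ≡ y × v ≡ x) ⊎ (w ≡ x × v ≡ y)
  merge-fibre w v e with y ≟F w | y ≟F v
  ... | yes y≡w | yes y≡v = inj₁ (trans (sym y≡w) y≡v)
  ... | yes y≡w | no y≢v  = inj₂ (inj₁ (sym y≡w , sym (punchOut-injective y≢x y≢v e)))
  ... | no y≢w  | yes y≡v = inj₂ (inj₂ (punchOut-injective y≢w y≢x e , sym y≡v))
  ... | no y≢w  | no y≢v  = inj₁ (punchOut-injective y≢w y≢v e)

  δ-merge-x : ∀ w → δ (merge w) (merge x) ≡ δ w x xor δ w y
  δ-merge-x w with merge w ≟F merge x
  ... | no ne = sym (cong₂ _xor_ (δ-≢ (ne ∘ cong merge))
                                 (δ-≢ (λ w≡y → ne (trans (cong merge w≡y) merge-y))))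
  ... | yes e with merge-fibre w x e
  ...   | inj₁ refl              = sym (cong₂ _xor_ (δ-refl w) (δ-≢ x≢y))
  ...   | inj₂ (inj₁ (refl , _)) = sym (cong₂ _xor_ (δ-≢ y≢x) (δ-refl y))
  ...   | inj₂ (inj₂ (_ , x≡y))  = ⊥-elim (x≢y x≡y)

  δ-merge-other : ∀ w v → v ≢ x → v ≢ y → δ (merge w) (merge v) ≡ δ w v
  δ-merge-other w v v≢x v≢y with merge w ≟F merge v
  ... | no ne = sym (δ-≢ (ne ∘ cong merge))
  ... | yes e with merge-fibre w v e
  ...   | inj₁ refl              = sym (δ-refl w)
  ...   | inj₂ (inj₁ (_ , v≡x)) = ⊥-elim (v≢x v≡x)
  ...   | inj₂ (inj₂ (_ , v≡y)) = ⊥-elim (v≢y v≡y)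

  push-merge-x : ∀ g → push merge g (merge x) ≡ g x xor g y
  push-merge-x g = begin
    sum (λ w → δ (merge w) (merge x) ∧ g w)
      ≡⟨ sum-cong-≗ (λ w → trans (cong (_∧ g w) (δ-merge-x w)) (∧-distribʳ-xor (g w) (δ w x) (δ w y))) ⟩
    sum (λ w → (δ w x ∧ g w) xor (δ w y ∧ g w))
      ≡⟨ ∑-distrib-+ (λ w → δ w x ∧ g w) (λ w → δ w y ∧ g w) ⟩
    sum (λ w → δ w x ∧ g w) xor sum (λ w → δ w y ∧ g w)
      ≡⟨ cong₂ _xor_ (sum-δ x g) (sum-δ y g) ⟩
    g x xor g y ∎

  push-merge-other : ∀ g v → v ≢ x → v ≢ y → push merge g (merge v) ≡ g v
  push-merge-other g v v≢x v≢y =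
    trans (sum-cong-≗ (λ w → cong (_∧ g w) (δ-merge-other w v v≢x v≢y))) (sum-δ v g)

  push-merge-injective : ∀ g h → push merge g ≗ push merge h → g y ≡ h y → g ≗ h
  push-merge-injective g h same gy≡hy w with w ≟F x | w ≟F y
  ... | _        | yes refl = gy≡hy
  ... | yes refl | no _     = begin
    g x                    ≡⟨ xor-cancelʳ (g x) (g y) ⟨
    (g x xor g y) xor g y  ≡⟨ cong₂ _xor_ (trans (sym (push-merge-x g)) (trans (same (merge x)) (push-merge-x h)))
                                          gy≡hy ⟩
    (h x xor h y) xor h y  ≡⟨ xor-cancelʳ (h x) (h y) ⟩
    h x                    ∎
  ... | no w≢x   | no w≢y   =
    trans (sym (push-merge-other g w w≢x w≢y)) (trans (same (merge w)) (push-merge-other h w w≢x w≢y))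

module Contraction {m k} (E : Graph (suc k) (suc (suc m))) (conn : Connected E) where

  separating : Σ (Fin (suc k)) λ j → Separates (λ z → δ z zero) (E j)
  separating = conn (λ z → δ z zero) zero (suc zero) (λ ())

  j : Fin (suc k)
  j = proj₁ separating

  x y : Fin (suc (suc m))
  x = proj₁ (E j)
  y = proj₂ (E j)

  x≢y : x ≢ y
  x≢y x≡y = proj₂ separating (cong (λ z → δ z zero) x≡y)

  open Merge x y x≢y public

  E/ : Graph k (suc m)
  E/ = mapEdge merge ∘ E ∘ punchIn j

  connected/ : Connected E/
  connected/ S z₁ z₂ Sz₁≢Sz₂ with conn (S ∘ merge) (punchIn y z₁) (punchIn y z₂) lifted
    where
    lifted : S (merge (punchIn y z₁)) ≢ S (merge (punchIn y z₂))
    lifted e = Sz₁≢Sz₂ (trans (cong S (sym (merge-punchIn z₁))) (trans e (cong S (merge-punchIn z₂))))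
  ... | i , sep with j ≟F i
  ...   | yes refl = ⊥-elim (sep (cong S (sym merge-y)))
  ...   | no j≢i   = punchOut j≢i , subst (λ i → Separates (S ∘ merge) (E i)) (sym (punchIn-punchOut j≢i)) sep

  -- Edge j becomes a loop, so the boundary of the contraction forgets it.
  ∂-contract : ∀ u → push merge (∂ E u) ≗ ∂ E/ (u ∘ punchIn j)
  ∂-contract u z = begin
    push merge (∂ E u) z
      ≡⟨ push-∂ merge E u z ⟩
    ∂ (mapEdge merge ∘ E) u z
      ≡⟨ sum-remove {i = j} (λ i → u i ∧ incident (mapEdge merge (E i)) z) ⟩
    (u j ∧ (δ z (merge x) xor δ z (merge y))) xor ∂ E/ (u ∘ punchIn j) z
      ≡⟨ cong (λ b → (u j ∧ (δ z (merge x) xor δ z b)) xor ∂ E/ (u ∘ punchIn j) z) merge-y ⟩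
    (u j ∧ (δ z (merge x) xor δ z (merge x))) xor ∂ E/ (u ∘ punchIn j) z
      ≡⟨ cong (λ b → (u j ∧ b) xor ∂ E/ (u ∘ punchIn j) z) (xor-same (δ z (merge x))) ⟩
    (u j ∧ false) xor ∂ E/ (u ∘ punchIn j) z
      ≡⟨ cong (_xor ∂ E/ (u ∘ punchIn j) z) (∧-zeroʳ (u j)) ⟩
    ∂ E/ (u ∘ punchIn j) z ∎

  ∂-at-y : ∀ u → ∂ E u y ≡ u j xor ∂ (E ∘ punchIn j) (u ∘ punchIn j) y
  ∂-at-y u = trans (sum-remove {i = j} (λ i → u i ∧ incident (E i) y))
                   (cong (_xor ∂ (E ∘ punchIn j) (u ∘ punchIn j) y)
                         (trans (cong (u j ∧_) (cong₂ _xor_ (δ-≢ y≢x) (δ-refl y))) (∧-identityʳ (u j))))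

connected⇒edges : ∀ m {k} (E : Graph k (suc m)) → Connected E → m ≤ k
connected⇒edges zero    E conn = z≤n
connected⇒edges (suc m) {zero} E conn with conn (λ z → δ z zero) zero (suc zero) (λ ())
... | () , _
connected⇒edges (suc m) {suc k} E conn =
  s≤s (connected⇒edges m (Contraction.E/ E conn) (Contraction.connected/ E conn))

loop-unique : ∀ m (E : Graph (suc m) (suc m)) → Connected E →
              ∀ i i′ → IsLoop (E i) → IsLoop (E i′) → i ≡ i′
loop-unique zero    E conn zero zero _ _ = refl
loop-unique (suc m) E conn i i′ loop loop′ with i ≟F i′
... | yes i≡i′ = i≡i′
... | no i≢i′  = ⊥-elim (1+n≰n (connected⇒edges (suc m) (E′ ∘ punchIn j′) conn″))
  where
  E′ : Graph (suc m) (suc (suc m))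
  E′ = E ∘ punchIn i
  j′ : Fin (suc m)
  j′ = punchOut i≢i′
  loop-j′ : IsLoop (E′ j′)
  loop-j′ = subst (IsLoop ∘ E) (sym (punchIn-punchOut i≢i′)) loop′
  conn″ : Connected (E′ ∘ punchIn j′)
  conn″ = connected-dropLoop E′ j′ loop-j′ (connected-dropLoop E i loop conn)

add-cycle : ∀ {k n} (E : Graph k n) {r : Fin n → Bool} (u c : Fin k → Bool) →
            ∂ E u ≗ r → ∂ E c ≗ (λ _ → false) → ∂ E (λ i → u i xor c i) ≗ r
add-cycle E {r} u c u-solves c-cycle z =
  trans (∂-xor E u c z) (trans (cong₂ _xor_ (u-solves z) (c-cycle z)) (xor-identityʳ (r z)))

record TwoSolutions {k n} (E : Graph k n) (r : Fin n → Bool) : Set where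
  field
    u₀ c      : Fin k → Bool
    i₀        : Fin k
    c-i₀      : c i₀ ≡ true
    u₀-solves : ∂ E u₀ ≗ r
    c-cycle   : ∂ E c ≗ (λ _ → false)
    solutions : ∀ u → ∂ E u ≗ r → u ≗ u₀ ⊎ u ≗ (λ i → u₀ i xor c i)

-- One vertex and one edge, necessarily a loop: every u solves ∂ u = 0.
twoSolutions-base : (E : Graph 1 1) (r : Fin 1 → Bool) → sum r ≡ false → TwoSolutions E r
twoSolutions-base E r even = record
  { u₀ = λ _ → false ; c = λ _ → true ; i₀ = zero ; c-i₀ = refl
  ; u₀-solves = λ z → trans (∂-vanishes (λ _ → false) z) (sym (r-vanishes z))
  ; c-cycle = ∂-vanishes (λ _ → true)
  ; solutions = λ u _ → by-value u (u zero) refl }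
  where
  loop-incident : (e : Edge 1) (z : Fin 1) → incident e z ≡ false
  loop-incident (zero , zero) zero = refl
  ∂-vanishes : ∀ u → ∂ E u ≗ (λ _ → false)
  ∂-vanishes u zero = trans (cong (λ b → (u zero ∧ b) xor false) (loop-incident (E zero) zero))
                            (cong (_xor false) (∧-zeroʳ (u zero)))
  r-vanishes : ∀ z → r z ≡ false
  r-vanishes zero = trans (sym (xor-identityʳ (r zero))) even
  by-value : ∀ (u : Fin 1 → Bool) b → u zero ≡ b →
             u ≗ (λ _ → false) ⊎ u ≗ (λ _ → false xor true)
  by-value u false u0 = inj₁ λ { zero → u0 }
  by-value u true  u0 = inj₂ λ { zero → u0 }

-- Inductive step: solutions for E correspond to solutions for its contraction E/,
-- the value on the contracted edge j being forced by the equation at y.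
module TwoSolutionsStep {m} (E : Graph (suc (suc m)) (suc (suc m))) (conn : Connected E)
    (r : Fin (suc (suc m)) → Bool) (IH : TwoSolutions (Contraction.E/ E conn) (push (Contraction.merge E conn) r)) where

  open Contraction E conn
  module IH = TwoSolutions IH

  rest : (Fin (suc m) → Bool) → Bool
  rest v = ∂ (E ∘ punchIn j) v y

  extend : ∀ (s : Fin (suc (suc m)) → Bool) (v : Fin (suc m) → Bool) → Fin (suc (suc m)) → Bool
  extend s v = insertAt v j (s y xor rest v)

  extend-restricts : ∀ s v → extend s v ∘ punchIn j ≗ v
  extend-restricts s v = insertAt-punchIn v j (s y xor rest v)

  extend-solves : ∀ s v → ∂ E/ v ≗ push merge s → ∂ E (extend s v) ≗ s
  extend-solves s v v-solves = push-merge-injective (∂ E (extend s v)) s pushed at-y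
    where
    restricts : extend s v ∘ punchIn j ≗ v
    restricts = extend-restricts s v
    pushed : push merge (∂ E (extend s v)) ≗ push merge s
    pushed z = trans (∂-contract (extend s v) z) (trans (∂-cong E/ restricts z) (v-solves z))
    at-y : ∂ E (extend s v) y ≡ s y
    at-y = begin
      ∂ E (extend s v) y
        ≡⟨ ∂-at-y (extend s v) ⟩
      extend s v j xor rest (extend s v ∘ punchIn j)
        ≡⟨ cong₂ _xor_ (insertAt-lookup v j (s y xor rest v)) (∂-cong (E ∘ punchIn j) restricts y) ⟩
      (s y xor rest v) xor rest v
        ≡⟨ xor-cancelʳ (s y) (rest v) ⟩
      s y ∎

  restriction-solves : ∀ u → ∂ E u ≗ r → ∂ E/ (u ∘ punchIn j) ≗ push merge r
  restriction-solves u u-solves z =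
    trans (sym (∂-contract u z)) (sum-cong-≗ (λ w → cong (δ (merge w) z ∧_) (u-solves w)))

  value-at-j : ∀ u → ∂ E u ≗ r → u j ≡ r y xor rest (u ∘ punchIn j)
  value-at-j u u-solves =
    trans (sym (xor-cancelʳ (u j) (rest (u ∘ punchIn j))))
          (cong (_xor rest (u ∘ punchIn j)) (trans (sym (∂-at-y u)) (u-solves y)))

  agree-off-j : ∀ u v → ∂ E u ≗ r → ∂ E v ≗ r → u ∘ punchIn j ≗ v ∘ punchIn j → u ≗ v
  agree-off-j u v u-solves v-solves off-j = ≗-split j at-j off-j
    where
    at-j : u j ≡ v j
    at-j = trans (value-at-j u u-solves)
                 (trans (cong (r y xor_) (∂-cong (E ∘ punchIn j) off-j y)) (sym (value-at-j v v-solves)))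

  u₀ c : Fin (suc (suc m)) → Bool
  u₀ = extend r IH.u₀
  c  = extend (λ _ → false) IH.c

  u₀-solves : ∂ E u₀ ≗ r
  u₀-solves = extend-solves r IH.u₀ IH.u₀-solves

  c-cycle : ∂ E c ≗ (λ _ → false)
  c-cycle = extend-solves (λ _ → false) IH.c (λ z → trans (IH.c-cycle z) (sym (push-zero merge z)))

  solutions : ∀ u → ∂ E u ≗ r → u ≗ u₀ ⊎ u ≗ (λ i → u₀ i xor c i)
  solutions u u-solves = Data.Sum.map via-u₀ via-u₁ (IH.solutions (u ∘ punchIn j) (restriction-solves u u-solves))
    where
    via-u₀ : u ∘ punchIn j ≗ IH.u₀ → u ≗ u₀
    via-u₀ same = agree-off-j u u₀ u-solves u₀-solves
                    (λ i → trans (same i) (sym (extend-restricts r IH.u₀ i)))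
    via-u₁ : u ∘ punchIn j ≗ (λ i → IH.u₀ i xor IH.c i) → u ≗ (λ i → u₀ i xor c i)
    via-u₁ same = agree-off-j u (λ i → u₀ i xor c i) u-solves (add-cycle E u₀ c u₀-solves c-cycle)
                    (λ i → trans (same i) (sym (cong₂ _xor_ (extend-restricts r IH.u₀ i)
                                                            (extend-restricts (λ _ → false) IH.c i))))

  result : TwoSolutions E r
  result = record
    { u₀ = u₀ ; c = c ; i₀ = punchIn j IH.i₀
    ; c-i₀ = trans (extend-restricts (λ _ → false) IH.c IH.i₀) IH.c-i₀
    ; u₀-solves = u₀-solves ; c-cycle = c-cycle ; solutions = solutions }

twoSolutions : ∀ m (E : Graph (suc m) (suc m)) → Connected E →
               ∀ r → sum r ≡ false → TwoSolutions E r
twoSolutions zero    E conn r even = twoSolutions-base E r even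
twoSolutions (suc m) E conn r even =
  TwoSolutionsStep.result E conn r
    (twoSolutions m E/ connected/ (push merge r) (trans (push-total merge r) even))
  where open Contraction E conn

vec-ext : ∀ {A : Set} {k} {v w : Vec A k} → (∀ i → lookup v i ≡ lookup w i) → v ≡ w
vec-ext same = Pointwise-≡⇒≡ (ext same)

base : ∀ {n} → SPerm n → Fin n → Fin n
base σ k = proj₁ (lookup σ k)

sign : ∀ {n} → SPerm n → Fin n → Bool
sign σ k = proj₂ (lookup σ k)

signed-ext : ∀ {n} {σ τ : SPerm n} → base σ ≗ base τ → sign σ ≗ sign τ → σ ≡ τ
signed-ext same-base same-sign = vec-ext (λ k → cong₂ _,_ (same-base k) (same-sign k))

swap : ∀ {n} → Edge n → Fin n → Fin n
swap (a , b) k = if δ k a then b else (if δ k b then a else k)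

swap-a : ∀ {n} (a b : Fin n) → swap (a , b) a ≡ b
swap-a a b rewrite δ-refl a = refl

swap-b : ∀ {n} (a b : Fin n) → swap (a , b) b ≡ a
swap-b a b with b ≟F a
... | yes refl = refl
... | no _ rewrite δ-refl b = refl

swap-other : ∀ {n} (a b k : Fin n) → k ≢ a → k ≢ b → swap (a , b) k ≡ k
swap-other a b k k≢a k≢b rewrite δ-≢ k≢a | δ-≢ k≢b = refl

swap-cases : ∀ {n} (a b k : Fin n) → k ≡ a ⊎ k ≡ b ⊎ (k ≢ a × k ≢ b)
swap-cases a b k with k ≟F a | k ≟F b
... | yes k≡a | _       = inj₁ k≡a
... | no _    | yes k≡b = inj₂ (inj₁ k≡b)
... | no k≢a  | no k≢b  = inj₂ (inj₂ (k≢a , k≢b))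

swap-involutive : ∀ {n} (e : Edge n) k → swap e (swap e k) ≡ k
swap-involutive (a , b) k with swap-cases a b k
... | inj₁ refl          = trans (cong (swap (k , b)) (swap-a k b)) (swap-b k b)
... | inj₂ (inj₁ refl)   = trans (cong (swap (a , k)) (swap-b a k)) (swap-a a k)
... | inj₂ (inj₂ (k≢a , k≢b)) =
  trans (cong (swap (a , b)) (swap-other a b k k≢a k≢b)) (swap-other a b k k≢a k≢b)

swap-preserves : ∀ {n} (S : Fin n → Bool) (a b : Fin n) → S a ≡ S b → ∀ k → S (swap (a , b) k) ≡ S k
swap-preserves S a b Sa≡Sb k with swap-cases a b k
... | inj₁ refl               = trans (cong S (swap-a k b)) (sym Sa≡Sb)
... | inj₂ (inj₁ refl)        = trans (cong S (swap-b a k)) Sa≡Sb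
... | inj₂ (inj₂ (k≢a , k≢b)) = cong S (swap-other a b k k≢a k≢b)

swap-moves : ∀ {n} (a b : Fin n) → a ≢ b → ∀ k → not (δ (swap (a , b) k) k) ≡ incident (a , b) k
swap-moves a b a≢b k with swap-cases a b k
... | inj₁ refl rewrite swap-a k b | δ-≢ (a≢b ∘ sym) | δ-refl k | δ-≢ a≢b = refl
... | inj₂ (inj₁ refl) rewrite swap-b a k | δ-≢ a≢b | δ-refl k | δ-≢ (a≢b ∘ sym) = refl
... | inj₂ (inj₂ (k≢a , k≢b)) rewrite swap-other a b k k≢a k≢b | δ-refl k | δ-≢ k≢a | δ-≢ k≢b = refl

incident-even : ∀ {n} (e : Edge n) → sum (incident e) ≡ false
incident-even (a , b) =
  trans (∑-distrib-+ (λ k → δ k a) (λ k → δ k b)) (cong₂ _xor_ (sum-δ-one a) (sum-δ-one b))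

swap-loop : ∀ {n} (c k : Fin n) → swap (c , c) k ≡ k
swap-loop c k with swap-cases c c k
... | inj₁ refl             = swap-a k k
... | inj₂ (inj₁ refl)      = swap-a k k
... | inj₂ (inj₂ (k≢c , _)) = swap-other c c k k≢c k≢c

bar-fixes : ∀ {n} (c k : Fin n) → base (bar c) k ≡ k
bar-fixes c k = cong proj₁ (lookup∘tabulate (λ k → k , ⌊ k ≟F c ⌋) k)

bar-base : ∀ {n} (c : Fin n) → base (bar c) ≗ swap (c , c)
bar-base c k = trans (bar-fixes c k) (sym (swap-loop c k))

bar-sign : ∀ {n} (c : Fin n) → sign (bar c) ≗ λ k → δ k c
bar-sign c k = cong proj₂ (lookup∘tabulate (λ k → k , ⌊ k ≟F c ⌋) k)

dswap-base : ∀ {n} (a : Fin n) s b t → base (dswap (a , s) (b , t)) ≗ swap (a , b)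
dswap-base a s b t k = trans (cong proj₁ (lookup∘tabulate _ k)) (by-cases (δ k a) (δ k b))
  where
  by-cases : ∀ p q → proj₁ (if p then (b , t xor s) else (if q then (a , s xor t) else (k , false)))
                     ≡ (if p then b else (if q then a else k))
  by-cases true  q     = refl
  by-cases false true  = refl
  by-cases false false = refl

dswap-sign : ∀ {n} (a : Fin n) s b t → a ≢ b → sign (dswap (a , s) (b , t)) ≗ λ k → (s xor t) ∧ incident (a , b) k
dswap-sign a s b t a≢b k = trans (cong proj₂ (lookup∘tabulate _ k)) (by-cases (k ≟F a) (k ≟F b))
  where
  by-cases : ∀ p q → proj₂ (if ⌊ p ⌋ then (b , t xor s) else (if ⌊ q ⌋ then (a , s xor t) else (k , false)))
                     ≡ (s xor t) ∧ (⌊ p ⌋ xor ⌊ q ⌋)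
  by-cases (yes refl) (yes refl) = ⊥-elim (a≢b refl)
  by-cases (yes _)    (no _)     = trans (xor-comm t s) (sym (∧-identityʳ (s xor t)))
  by-cases (no _)     (yes _)    = sym (∧-identityʳ (s xor t))
  by-cases (no _)     (no _)     = sym (∧-zeroʳ (s xor t))

plus-base : ∀ {n} (σ : SPerm n) → base (plus σ) ≗ base σ
plus-base σ k = cong proj₁ (lookup-map k (λ x → proj₁ x , false) σ)

plus-sign : ∀ {n} (σ : SPerm n) → sign (plus σ) ≗ λ _ → false
plus-sign σ k = cong proj₂ (lookup-map k (λ x → proj₁ x , false) σ)

absP-cong : ∀ {n} {σ τ : SPerm n} → base σ ≗ base τ → absP σ ≡ absP τ
absP-cong {σ = σ} {τ} same = vec-ext (λ k → trans (lookup-map k proj₁ σ) (trans (same k) (sym (lookup-map k proj₁ τ))))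

absP-plus : ∀ {n} (σ : SPerm n) → absP (plus σ) ≡ absP σ
absP-plus σ = absP-cong (plus-base σ)

plus-idempotent : ∀ {n} (σ : SPerm n) → plus σ ≡ plus (plus σ)
plus-idempotent σ = signed-ext (λ k → sym (plus-base (plus σ) k))
                               (λ k → trans (plus-sign σ k) (sym (plus-sign (plus σ) k)))

endpoints : ∀ {n} {σ : SPerm n} → IsBTransposition σ → Edge n
endpoints (inj₁ (c , _))                 = c , c
endpoints (inj₂ ((a , _) , (b , _) , _)) = a , b

isBar : ∀ {n} {σ : SPerm n} → IsBTransposition σ → Bool
isBar (inj₁ _) = true
isBar (inj₂ _) = false

transposition-base : ∀ {n} {σ : SPerm n} (t : IsBTransposition σ) → base σ ≗ swap (endpoints t)
transposition-base (inj₁ (c , refl))                           = bar-base c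
transposition-base (inj₂ ((a , s) , (b , t) , _ , refl)) = dswap-base a s b t

transposition-parity : ∀ {n} {σ : SPerm n} (t : IsBTransposition σ) → sum (sign σ) ≡ isBar t
transposition-parity (inj₁ (c , refl)) = trans (sum-cong-≗ (bar-sign c)) (sum-δ-one c)
transposition-parity (inj₂ ((a , s) , (b , t) , a≢b , refl)) = begin
  sum (sign (dswap (a , s) (b , t)))          ≡⟨ sum-cong-≗ (dswap-sign a s b t a≢b) ⟩
  sum (λ k → (s xor t) ∧ incident (a , b) k) ≡⟨ *-distribˡ-sum (s xor t) (incident (a , b)) ⟨
  (s xor t) ∧ sum (incident (a , b))          ≡⟨ cong ((s xor t) ∧_) (incident-even (a , b)) ⟩
  (s xor t) ∧ false                            ≡⟨ ∧-zeroʳ (s xor t) ⟩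
  false                                        ∎

bar-loop : ∀ {n} {σ : SPerm n} (t : IsBTransposition σ) → isBar t ≡ true → IsLoop (endpoints t)
bar-loop (inj₁ _) _ = refl
bar-loop (inj₂ _) ()

signedSwap : ∀ {n} → Fin n → Fin n → Bool → SPerm n
signedSwap a b u = dswap (a , false) (b , u)

signedSwap-transposition : ∀ {n} {a b : Fin n} u → a ≢ b → IsBTransposition (signedSwap a b u)
signedSwap-transposition {a = a} {b} u a≢b = inj₂ ((a , false) , (b , u) , a≢b , refl)

plus-dswap : ∀ {n} (a : Fin n) s b t → a ≢ b → plus (dswap (a , s) (b , t)) ≡ signedSwap a b false
plus-dswap a s b t a≢b =
  signed-ext (λ k → trans (plus-base σ k) (trans (dswap-base a s b t k) (sym (dswap-base a false b false k))))
             (λ k → trans (plus-sign σ k) (sym (dswap-sign a false b false a≢b k)))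
  where
  σ = dswap (a , s) (b , t)

plus-transposition : ∀ {n} {σ : SPerm n} (t : IsBTransposition σ) → isBar t ≡ false → IsBTransposition (plus σ)
plus-transposition (inj₁ _) ()
plus-transposition (inj₂ ((a , s) , (b , t) , a≢b , refl)) _ =
  subst IsBTransposition (sym (plus-dswap a s b t a≢b)) (signedSwap-transposition false a≢b)

positive-transposition : ∀ {n} {σ : SPerm n} → IsBTransposition σ → σ ≡ plus σ →
                         Σ (Edge n) λ e → proj₁ e ≢ proj₂ e × σ ≡ signedSwap (proj₁ e) (proj₂ e) false
positive-transposition (inj₁ (c , refl)) positive = ⊥-elim (true≢false sign-c)
  where
  true≢false : true ≢ false
  true≢false ()
  sign-c : true ≡ false
  sign-c = trans (sym (trans (bar-sign c c) (δ-refl c)))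
                 (trans (cong (λ σ → sign σ c) positive) (plus-sign (bar c) c))
positive-transposition (inj₂ ((a , s) , (b , t) , a≢b , refl)) positive =
  (a , b) , a≢b , trans positive (plus-dswap a s b t a≢b)

lifts-of-positive : ∀ {n} {a b : Fin n} {τ : SPerm n} → a ≢ b → IsBTransposition τ →
                    plus τ ≡ signedSwap a b false → τ ≡ signedSwap a b (sign τ a)
lifts-of-positive {a = a} {b} {τ} a≢b t erased = by-shape t
  where
  base-τ : base τ ≗ swap (a , b)
  base-τ k = trans (sym (plus-base τ k)) (trans (cong (λ σ → base σ k) erased) (dswap-base a false b false k))
  by-shape : IsBTransposition τ → τ ≡ signedSwap a b (sign τ a)
  by-shape (inj₁ (c , refl)) =
    ⊥-elim (a≢b (trans (sym (bar-fixes c a)) (trans (base-τ a) (swap-a a b))))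
  by-shape (inj₂ ((c , s) , (d , t) , c≢d , refl)) =
    signed-ext (λ k → trans (base-τ k) (sym (dswap-base a false b (sign τ a) k))) same-sign
    where
    sign-τ : ∀ k → sign τ k ≡ (s xor t) ∧ incident (a , b) k
    sign-τ k = begin
      sign τ k                                      ≡⟨ dswap-sign c s d t c≢d k ⟩
      (s xor t) ∧ incident (c , d) k               ≡⟨ cong ((s xor t) ∧_) (swap-moves c d c≢d k) ⟨
      (s xor t) ∧ not (δ (swap (c , d) k) k)       ≡⟨ cong (λ z → (s xor t) ∧ not (δ z k))
                                                           (trans (sym (dswap-base c s d t k)) (base-τ k)) ⟩
      (s xor t) ∧ not (δ (swap (a , b) k) k)       ≡⟨ cong ((s xor t) ∧_) (swap-moves a b a≢b k) ⟩
      (s xor t) ∧ incident (a , b) k               ∎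
    sign-τ-a : sign τ a ≡ s xor t
    sign-τ-a = trans (sign-τ a) (trans (cong₂ (λ z w → (s xor t) ∧ (z xor w)) (δ-refl a) (δ-≢ a≢b))
                                       (∧-identityʳ (s xor t)))
    same-sign : sign τ ≗ sign (signedSwap a b (sign τ a))
    same-sign k = trans (sign-τ k) (trans (cong (_∧ incident (a , b) k) (sym sign-τ-a))
                                          (sym (dswap-sign a false b (sign τ a) a≢b k)))

baseProd : ∀ {n k} → Vec (SPerm n) k → Fin n → Fin n
baseProd τs = base (prodB τs)

signProd : ∀ {n k} → Vec (SPerm n) k → Fin n → Bool
signProd τs = sign (prodB τs)

prodB-nil : ∀ {n} (x : Fin n) → lookup (prodB {n} []) x ≡ (x , false)
prodB-nil x = lookup∘tabulate (λ i → i , false) x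

prodB-cons : ∀ {n k} (τ : SPerm n) (τs : Vec (SPerm n) k) x →
             lookup (prodB (τ ∷ τs)) x ≡ (base τ (baseProd τs x) , sign τ (baseProd τs x) xor signProd τs x)
prodB-cons τ τs x = trans (lookup∘tabulate (λ i → apply τ (lookup (prodB τs) i)) x) (apply-lookup (lookup (prodB τs) x))
  where
  apply-lookup : ∀ y → apply τ y ≡ (base τ (proj₁ y) , sign τ (proj₁ y) xor proj₂ y)
  apply-lookup (i , s) with lookup τ i
  ... | j , t = refl

suffix : ∀ {n k} → Vec (SPerm n) k → Fin k → Fin n → Fin n
suffix (τ ∷ τs) zero    = baseProd τs
suffix (τ ∷ τs) (suc i) = suffix τs i

signProd-sum : ∀ {n k} (τs : Vec (SPerm n) k) x →
               signProd τs x ≡ sum (λ i → sign (lookup τs i) (suffix τs i x))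
signProd-sum []       x = cong proj₂ (prodB-nil x)
signProd-sum (τ ∷ τs) x = trans (cong proj₂ (prodB-cons τ τs x)) (cong (sign τ (baseProd τs x) xor_) (signProd-sum τs x))

SameBase : ∀ {n k} → Vec (SPerm n) k → Vec (SPerm n) k → Set
SameBase τs τs′ = ∀ i → base (lookup τs i) ≗ base (lookup τs′ i)

baseProd-cong : ∀ {n k} (τs τs′ : Vec (SPerm n) k) → SameBase τs τs′ → baseProd τs ≗ baseProd τs′
baseProd-cong []       []         same x = refl
baseProd-cong (τ ∷ τs) (τ′ ∷ τs′) same x = begin
  baseProd (τ ∷ τs) x      ≡⟨ cong proj₁ (prodB-cons τ τs x) ⟩
  base τ (baseProd τs x)   ≡⟨ cong (base τ) (baseProd-cong τs τs′ (same ∘ suc) x) ⟩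
  base τ (baseProd τs′ x)  ≡⟨ same zero (baseProd τs′ x) ⟩
  base τ′ (baseProd τs′ x) ≡⟨ cong proj₁ (prodB-cons τ′ τs′ x) ⟨
  baseProd (τ′ ∷ τs′) x    ∎

suffix-cong : ∀ {n k} (τs τs′ : Vec (SPerm n) k) → SameBase τs τs′ → ∀ i → suffix τs i ≗ suffix τs′ i
suffix-cong (τ ∷ τs) (τ′ ∷ τs′) same zero    = baseProd-cong τs τs′ (same ∘ suc)
suffix-cong (τ ∷ τs) (τ′ ∷ τs′) same (suc i) = suffix-cong τs τs′ (same ∘ suc) i

Involutive : ∀ {n k} → Vec (SPerm n) k → Set
Involutive τs = ∀ i k → base (lookup τs i) (base (lookup τs i) k) ≡ k

baseProdInv : ∀ {n k} → Vec (SPerm n) k → Fin n → Fin n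
baseProdInv []       y = y
baseProdInv (τ ∷ τs) y = baseProdInv τs (base τ y)

suffixInv : ∀ {n k} → Vec (SPerm n) k → Fin k → Fin n → Fin n
suffixInv (τ ∷ τs) zero    = baseProdInv τs
suffixInv (τ ∷ τs) (suc i) = suffixInv τs i

baseProd-inverseʳ : ∀ {n k} (τs : Vec (SPerm n) k) → Involutive τs → ∀ y → baseProd τs (baseProdInv τs y) ≡ y
baseProd-inverseʳ []       inv y = cong proj₁ (prodB-nil y)
baseProd-inverseʳ (τ ∷ τs) inv y = begin
  baseProd (τ ∷ τs) (baseProdInv τs (base τ y))      ≡⟨ cong proj₁ (prodB-cons τ τs _) ⟩
  base τ (baseProd τs (baseProdInv τs (base τ y)))   ≡⟨ cong (base τ) (baseProd-inverseʳ τs (inv ∘ suc) (base τ y)) ⟩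
  base τ (base τ y)                                  ≡⟨ inv zero y ⟩
  y                                                  ∎

baseProd-inverseˡ : ∀ {n k} (τs : Vec (SPerm n) k) → Involutive τs → ∀ x → baseProdInv τs (baseProd τs x) ≡ x
baseProd-inverseˡ []       inv x = cong proj₁ (prodB-nil x)
baseProd-inverseˡ (τ ∷ τs) inv x = begin
  baseProdInv τs (base τ (baseProd (τ ∷ τs) x))      ≡⟨ cong (baseProdInv τs ∘ base τ) (cong proj₁ (prodB-cons τ τs x)) ⟩
  baseProdInv τs (base τ (base τ (baseProd τs x)))   ≡⟨ cong (baseProdInv τs) (inv zero (baseProd τs x)) ⟩
  baseProdInv τs (baseProd τs x)                     ≡⟨ baseProd-inverseˡ τs (inv ∘ suc) x ⟩
  x                                                  ∎

suffix-inverseʳ : ∀ {n k} (τs : Vec (SPerm n) k) → Involutive τs → ∀ i y → suffix τs i (suffixInv τs i y) ≡ y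
suffix-inverseʳ (τ ∷ τs) inv zero    = baseProd-inverseʳ τs (inv ∘ suc)
suffix-inverseʳ (τ ∷ τs) inv (suc i) = suffix-inverseʳ τs (inv ∘ suc) i

suffix-inverseˡ : ∀ {n k} (τs : Vec (SPerm n) k) → Involutive τs → ∀ i x → suffixInv τs i (suffix τs i x) ≡ x
suffix-inverseˡ (τ ∷ τs) inv zero    = baseProd-inverseˡ τs (inv ∘ suc)
suffix-inverseˡ (τ ∷ τs) inv (suc i) = suffix-inverseˡ τs (inv ∘ suc) i

incident-suffix : ∀ {n k} (τs : Vec (SPerm n) k) → Involutive τs → ∀ i (e : Edge n) x →
                  incident e (suffix τs i x) ≡ incident (mapEdge (suffixInv τs i) e) x
incident-suffix τs inv i (a , b) x = cong₂ _xor_ (δ-pullback a) (δ-pullback b)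
  where
  δ-pullback : ∀ c → δ (suffix τs i x) c ≡ δ x (suffixInv τs i c)
  δ-pullback c with suffix τs i x ≟F c | x ≟F suffixInv τs i c
  ... | yes _ | yes _ = refl
  ... | no _  | no _  = refl
  ... | yes e | no ne = ⊥-elim (ne (trans (sym (suffix-inverseˡ τs inv i x)) (cong (suffixInv τs i) e)))
  ... | no ne | yes e = ⊥-elim (ne (trans (cong (suffix τs i) e) (suffix-inverseʳ τs inv i c)))

SwapBase : ∀ {n k} → Vec (SPerm n) k → Graph k n → Set
SwapBase τs G = ∀ i → base (lookup τs i) ≗ swap (G i)

swapBase-involutive : ∀ {n k} (τs : Vec (SPerm n) k) (G : Graph k n) → SwapBase τs G → Involutive τs
swapBase-involutive τs G swaps i k =
  trans (swaps i _) (trans (cong (swap (G i)) (swaps i k)) (swap-involutive (G i) k))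

trajectory : ∀ {n k} → Vec (SPerm n) k → Graph k n → Graph k n
trajectory τs G i = mapEdge (suffixInv τs i) (G i)

-- If τ_i carries the sign u i on the points it moves, the signs of the product are
-- the boundary of u in the trajectory graph, which may be computed from any σs
-- with the same bases as τs.
signProd-∂ : ∀ {n k} (τs σs : Vec (SPerm n) k) (G : Graph k n) (u : Fin k → Bool) →
             SameBase τs σs → SwapBase σs G →
             (∀ i → sign (lookup τs i) ≗ λ z → u i ∧ incident (G i) z) →
             signProd τs ≗ ∂ (trajectory σs G) u
signProd-∂ τs σs G u same swaps signs x = trans (signProd-sum τs x) (sum-cong-≗ factor)
  where
  factor : ∀ i → sign (lookup τs i) (suffix τs i x) ≡ u i ∧ incident (trajectory σs G i) x
  factor i = begin
    sign (lookup τs i) (suffix τs i x)    ≡⟨ cong (sign (lookup τs i)) (suffix-cong τs σs same i x) ⟩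
    sign (lookup τs i) (suffix σs i x)    ≡⟨ signs i (suffix σs i x) ⟩
    u i ∧ incident (G i) (suffix σs i x)  ≡⟨ cong (u i ∧_) (incident-suffix σs (swapBase-involutive σs G swaps) i (G i) x) ⟩
    u i ∧ incident (trajectory σs G i) x  ∎

bar-parity : ∀ {n k} (τs : Vec (SPerm n) k) (ts : ∀ i → IsBTransposition (lookup τs i)) →
             sum (λ i → isBar (ts i)) ≡ sum (signProd τs)
bar-parity τs ts = begin
  sum (λ i → isBar (ts i))
    ≡⟨ sum-cong-≗ (λ i → sym (transposition-parity (ts i))) ⟩
  sum (λ i → sum (sign (lookup τs i)))
    ≡⟨ sum-cong-≗ (λ i → sym (sum-reindex (suffix τs i) (suffixInv τs i)
                                           (suffix-inverseʳ τs inv i) (suffix-inverseˡ τs inv i)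
                                           (sign (lookup τs i)))) ⟩
  sum (λ i → sum (λ x → sign (lookup τs i) (suffix τs i x)))
    ≡⟨ ∑-comm (λ i x → sign (lookup τs i) (suffix τs i x)) ⟩
  sum (λ x → sum (λ i → sign (lookup τs i) (suffix τs i x)))
    ≡⟨ sum-cong-≗ (λ x → sym (signProd-sum τs x)) ⟩
  sum (signProd τs) ∎
  where
  inv : Involutive τs
  inv = swapBase-involutive τs (endpoints ∘ ts) (λ i → transposition-base (ts i))

Preserves : ∀ {n} → (Fin n → Bool) → Perm n → Set
Preserves S π = ∀ k → S (lookup π k) ≡ S k

generated-preserves : ∀ {n k} (S : Fin n → Bool) {gs : Vec (Perm n) k} →
                      (∀ {g} → g ∈ gs → Preserves S g) → ∀ {π} → InGen gs π → Preserves S π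
generated-preserves S gens (gen-gen g∈gs) = gens g∈gs
generated-preserves S gens gen-id k = cong S (lookup∘tabulate (λ i → i) k)
generated-preserves S gens (gen-mul {π} {ρ} π-pres ρ-pres) k =
  trans (cong S (lookup∘tabulate (λ i → lookup π (lookup ρ i)) k))
        (trans (generated-preserves S gens π-pres (lookup ρ k)) (generated-preserves S gens ρ-pres k))
generated-preserves S gens (gen-inv {π} {ρ} π-pres πρ≡id) k = begin
  S (lookup ρ k)                       ≡⟨ generated-preserves S gens π-pres (lookup ρ k) ⟨
  S (lookup π (lookup ρ k))            ≡⟨ cong S (lookup∘tabulate (λ i → lookup π (lookup ρ i)) k) ⟨
  S (lookup (π ∘S ρ) k)                ≡⟨ cong (λ σ → S (lookup σ k)) πρ≡id ⟩
  S (lookup idS k)                     ≡⟨ cong S (lookup∘tabulate (λ i → i) k) ⟩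
  S k                                  ∎

transpositionS : ∀ {n} → Fin n → Fin n → Perm n
transpositionS x y = tabulate (swap (x , y))

transpositionS-isPerm : ∀ {n} (x y : Fin n) → IsPerm (transpositionS x y)
transpositionS-isPerm x y i j same = begin
  i                                ≡⟨ swap-involutive (x , y) i ⟨
  swap (x , y) (swap (x , y) i)    ≡⟨ cong (swap (x , y)) (trans (sym (lookup∘tabulate (swap (x , y)) i))
                                                          (trans same (lookup∘tabulate (swap (x , y)) j))) ⟩
  swap (x , y) (swap (x , y) j)    ≡⟨ swap-involutive (x , y) j ⟩
  j                                ∎

-- If no edge of the trajectory graph separates S, every factor preserves S:
-- by induction on the factors, the last ones preserving S already.
factors-preserve : ∀ {n k} (S : Fin n → Bool) (τs : Vec (SPerm n) k) (G : Graph k n) → SwapBase τs G →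
                   (∀ i → S (proj₁ (trajectory τs G i)) ≡ S (proj₂ (trajectory τs G i))) →
                   ∀ i k → S (base (lookup τs i) k) ≡ S k
factors-preserve S (τ ∷ τs) G swaps monochromatic = by-index
  where
  later : ∀ i k → S (base (lookup τs i) k) ≡ S k
  later = factors-preserve S τs (G ∘ suc) (swaps ∘ suc) (monochromatic ∘ suc)
  baseProdInv-preserves : ∀ {k} (σs : Vec (SPerm _) k) → (∀ i k → S (base (lookup σs i) k) ≡ S k) →
                          ∀ y → S (baseProdInv σs y) ≡ S y
  baseProdInv-preserves []       pres y = refl
  baseProdInv-preserves (σ ∷ σs) pres y = trans (baseProdInv-preserves σs (pres ∘ suc) (base σ y)) (pres zero y)
  by-index : ∀ i k → S (base (lookup (τ ∷ τs) i) k) ≡ S k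
  by-index zero    k = trans (cong S (swaps zero k)) (swap-preserves S a b Sa≡Sb k)
    where
    a = proj₁ (G zero)
    b = proj₂ (G zero)
    Sa≡Sb : S a ≡ S b
    Sa≡Sb = trans (sym (baseProdInv-preserves τs later a))
                  (trans (monochromatic zero) (baseProdInv-preserves τs later b))
  by-index (suc i) k = later i k

generates⇒connected : ∀ {n k} (τs : Vec (SPerm n) k) (G : Graph k n) → SwapBase τs G →
                      Generates (map absP τs) → Connected (trajectory τs G)
generates⇒connected τs G swaps gen S x y Sx≢Sy
  with any? (λ i → ¬? (S (proj₁ (trajectory τs G i)) ≟B S (proj₂ (trajectory τs G i))))
... | yes separating = separating
... | no none = ⊥-elim (Sx≢Sy (sym (trans (cong S (sym swap-x)) swap-preserves-S)))
  where
  monochromatic : ∀ i → S (proj₁ (trajectory τs G i)) ≡ S (proj₂ (trajectory τs G i))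
  monochromatic i = decidable-stable (_ ≟B _) (λ sep → none (i , sep))
  generators-preserve : All (Preserves S) (map absP τs)
  generators-preserve = map⁺ (lookup⁻ (λ i k →
    trans (cong S (lookup-map k proj₁ (lookup τs i))) (factors-preserve S τs G swaps monochromatic i k)))
  swap-x : lookup (transpositionS x y) x ≡ y
  swap-x = trans (lookup∘tabulate (swap (x , y)) x) (swap-a x y)
  swap-preserves-S : S (lookup (transpositionS x y) x) ≡ S x
  swap-preserves-S = generated-preserves S (All.lookup generators-preserve)
                       (gen (transpositionS x y) (transpositionS-isPerm x y)) x

blockNext-base : ∀ {n} w w′ s l (k : Fin n) → proj₁ (blockNext w s l k) ≡ proj₁ (blockNext w′ s l k)
blockNext-base w w′ s l k = trans (if-float proj₁ ⌊ suc (toℕ k) <? s + l ⌋) (sym (if-float proj₁ ⌊ suc (toℕ k) <? s + l ⌋))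

blockNext-sign : ∀ {n} w s l (k : Fin n) → proj₂ (blockNext w s l k) ≡ (if ⌊ suc (toℕ k) <? s + l ⌋ then false else w)
blockNext-sign w s l k = if-float proj₂ ⌊ suc (toℕ k) <? s + l ⌋

twoCycles-lookup : ∀ w p q (k : Fin (p + q)) →
                   lookup (twoCycles w p q) k ≡ (if ⌊ toℕ k <? p ⌋ then blockNext w 0 p k else blockNext w p q k)
twoCycles-lookup w p q = lookup∘tabulate _

twoCycles-sign : ∀ w p q (k : Fin (p + q)) →
                 sign (twoCycles w p q) k ≡ (if ⌊ toℕ k <? p ⌋
                                             then (if ⌊ suc (toℕ k) <? p ⌋ then false else w)
                                             else (if ⌊ suc (toℕ k) <? p + q ⌋ then false else w))
twoCycles-sign w p q k =
  trans (cong proj₂ (twoCycles-lookup w p q k))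
        (trans (if-float proj₂ ⌊ toℕ k <? p ⌋) (if-cong₂ ⌊ toℕ k <? p ⌋ (blockNext-sign w 0 p k) (blockNext-sign w p q k)))

β≡plusγ : ∀ p q → betaPQ p q ≡ plus (gammaPQ p q)
β≡plusγ p q = signed-ext same-base (λ k → trans (no-signs k) (sym (plus-sign (gammaPQ p q) k)))
  where
  same-base : base (betaPQ p q) ≗ base (plus (gammaPQ p q))
  same-base k = begin
    base (betaPQ p q) k
      ≡⟨ cong proj₁ (twoCycles-lookup false p q k) ⟩
    proj₁ (if ⌊ toℕ k <? p ⌋ then blockNext false 0 p k else blockNext false p q k)
      ≡⟨ if-float proj₁ ⌊ toℕ k <? p ⌋ ⟩
    (if ⌊ toℕ k <? p ⌋ then proj₁ (blockNext false 0 p k) else proj₁ (blockNext false p q k))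
      ≡⟨ if-cong₂ ⌊ toℕ k <? p ⌋ (blockNext-base false true 0 p k) (blockNext-base false true p q k) ⟩
    (if ⌊ toℕ k <? p ⌋ then proj₁ (blockNext true 0 p k) else proj₁ (blockNext true p q k))
      ≡⟨ if-float proj₁ ⌊ toℕ k <? p ⌋ ⟨
    proj₁ (if ⌊ toℕ k <? p ⌋ then blockNext true 0 p k else blockNext true p q k)
      ≡⟨ cong proj₁ (twoCycles-lookup true p q k) ⟨
    base (gammaPQ p q) k
      ≡⟨ plus-base (gammaPQ p q) k ⟨
    base (plus (gammaPQ p q)) k ∎
  no-signs : sign (betaPQ p q) ≗ λ _ → false
  no-signs k = trans (twoCycles-sign false p q k)
                     (trans (if-cong₂ ⌊ toℕ k <? p ⌋ (if-eta ⌊ suc (toℕ k) <? p ⌋) (if-eta ⌊ suc (toℕ k) <? p + q ⌋))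
                            (if-eta ⌊ toℕ k <? p ⌋))

-- γ_{p,q} changes the sign exactly at the last points p and p + q of its two cycles,
-- so its signs have even total.
module GammaSigns (p′ q′ : ℕ) where

  p q n : ℕ
  p = suc p′
  q = suc q′
  n = p′ + q

  p′<n : p′ < n
  p′<n = m<m+n p′ (s≤s z≤n)

  lastP lastQ : Fin (p + q)
  lastP = fromℕ< (s≤s (m≤m+n p′ q))
  lastQ = fromℕ n

  δ-lastP : ∀ x → toℕ x ≡ p′ → δ x lastP ≡ true
  δ-lastP x t≡p′ = trans (cong (δ x) (toℕ-injective (trans (toℕ-fromℕ< _) (sym t≡p′)))) (δ-refl x)

  δ-lastQ : ∀ x → toℕ x ≡ n → δ x lastQ ≡ true
  δ-lastQ x t≡n = trans (cong (δ x) (toℕ-injective (trans (toℕ-fromℕ n) (sym t≡n)))) (δ-refl x)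

  ¬δ-lastP : ∀ x → toℕ x ≢ p′ → δ x lastP ≡ false
  ¬δ-lastP x t≢p′ = δ-≢ (λ x≡lastP → t≢p′ (trans (cong toℕ x≡lastP) (toℕ-fromℕ< _)))

  ¬δ-lastQ : ∀ x → toℕ x ≢ n → δ x lastQ ≡ false
  ¬δ-lastQ x t≢n = δ-≢ (λ x≡lastQ → t≢n (trans (cong toℕ x≡lastQ) (toℕ-fromℕ n)))

  γ-sign : ∀ x → sign (gammaPQ p q) x ≡ δ x lastP xor δ x lastQ
  γ-sign x = trans (twoCycles-sign true p q x) (by-cases (toℕ x <? p) (suc (toℕ x) <? p) (suc (toℕ x) <? p + q))
    where
    t = toℕ x
    by-cases : (d : Dec (t < p)) (d₁ : Dec (suc t < p)) (d₂ : Dec (suc t < p + q)) →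
               (if ⌊ d ⌋ then (if ⌊ d₁ ⌋ then false else true) else (if ⌊ d₂ ⌋ then false else true))
               ≡ δ x lastP xor δ x lastQ
    by-cases (yes t<p) (yes st<p) _ =
      sym (cong₂ _xor_ (¬δ-lastP x (<⇒≢ (≤-pred st<p)))
                       (¬δ-lastQ x (<⇒≢ (<-≤-trans (≤-pred st<p) (m≤m+n p′ q)))))
    by-cases (yes t<p) (no st≮p) _ =
      sym (cong₂ _xor_ (δ-lastP x t≡p′) (¬δ-lastQ x (λ t≡n → <⇒≢ p′<n (trans (sym t≡p′) t≡n))))
      where
      t≡p′ : t ≡ p′
      t≡p′ = ≤-antisym (≤-pred t<p) (≤-pred (≮⇒≥ st≮p))
    by-cases (no t≮p) _ (yes st<pq) =
      sym (cong₂ _xor_ (¬δ-lastP x (λ t≡p′ → t≮p (subst (_< p) (sym t≡p′) (n<1+n p′))))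
                       (¬δ-lastQ x (<⇒≢ (≤-pred st<pq))))
    by-cases (no t≮p) _ (no st≮pq) =
      sym (cong₂ _xor_ (¬δ-lastP x (λ t≡p′ → <⇒≢ p′<n (trans (sym t≡p′) t≡n))) (δ-lastQ x t≡n))
      where
      t≡n : t ≡ n
      t≡n = ≤-antisym (≤-pred (toℕ<n x)) (≤-pred (≮⇒≥ st≮pq))

  γ-sign-even : sum (sign (gammaPQ p q)) ≡ false
  γ-sign-even = trans (sum-cong-≗ γ-sign)
                      (trans (∑-distrib-+ (λ x → δ x lastP) (λ x → δ x lastQ))
                             (cong₂ _xor_ (sum-δ-one lastP) (sum-δ-one lastQ)))

Factorization : ∀ {n} → SPerm n → Vec (SPerm n) n → Set
Factorization ρ τs = All IsBTransposition τs × prodB τs ≡ ρ × Generates (map absP τs)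

PositiveFactorization : ∀ {n} → SPerm n → Vec (SPerm n) n → Set
PositiveFactorization ρ σs =
  All IsBTransposition σs × prodB σs ≡ ρ × Generates (map absP σs) × All (λ σ → σ ≡ plus σ) σs

plusAll-prodB : ∀ {n k} (τs : Vec (SPerm n) k) → prodB (plusAll τs) ≡ plus (prodB τs)
plusAll-prodB {k = k} τs = signed-ext same-base no-signs
  where
  factor : ∀ i → lookup (plusAll τs) i ≡ plus (lookup τs i)
  factor i = lookup-map i plus τs
  same-base : baseProd (plusAll τs) ≗ base (plus (prodB τs))
  same-base x = trans (baseProd-cong (plusAll τs) τs (λ i k → trans (cong (λ σ → base σ k) (factor i)) (plus-base (lookup τs i) k)) x)
                      (sym (plus-base (prodB τs) x))
  no-signs : signProd (plusAll τs) ≗ sign (plus (prodB τs))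
  no-signs x = begin
    signProd (plusAll τs) x
      ≡⟨ signProd-sum (plusAll τs) x ⟩
    sum (λ i → sign (lookup (plusAll τs) i) (suffix (plusAll τs) i x))
      ≡⟨ sum-cong-≗ (λ i → trans (cong (λ σ → sign σ (suffix (plusAll τs) i x)) (factor i))
                                 (plus-sign (lookup τs i) _)) ⟩
    sum {k} (λ _ → false)
      ≡⟨ sum-replicate-zero k ⟩
    false
      ≡⟨ plus-sign (prodB τs) x ⟨
    sign (plus (prodB τs)) x ∎

plusAll-absP : ∀ {n k} (τs : Vec (SPerm n) k) → map absP (plusAll τs) ≡ map absP τs
plusAll-absP τs = trans (sym (map-∘ absP plus τs)) (map-cong absP-plus τs)

-- In a factorization of ρ ∈ B_{m+1} whose signs have even total, no factor is a
-- bar: the bars have even number, and two bars would be two loops of the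
-- connected trajectory graph, which has m+1 edges on m+1 vertices.
no-bars : ∀ {m} (ρ : SPerm (suc m)) → sum (sign ρ) ≡ false →
          ∀ τs → (fact : Factorization ρ τs) → ∀ i → isBar (lookup⁺ (proj₁ fact) i) ≡ false
no-bars {m} ρ even τs (transp , prod , gen) i = ¬-not two-loops
  where
  ts : ∀ i → IsBTransposition (lookup τs i)
  ts = lookup⁺ transp
  G : Graph (suc m) (suc m)
  G = endpoints ∘ ts
  E : Graph (suc m) (suc m)
  E = trajectory τs G
  connected : Connected E
  connected = generates⇒connected τs G (transposition-base ∘ ts) gen
  loop : ∀ i → isBar (ts i) ≡ true → IsLoop (E i)
  loop i bar = cong (suffixInv τs i) (bar-loop (ts i) bar)
  bars-even : sum (λ i → isBar (ts i)) ≡ false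
  bars-even = trans (bar-parity τs ts) (trans (cong (sum ∘ sign) prod) even)
  two-loops : isBar (ts i) ≢ true
  two-loops bar-i = punchInᵢ≢i i j (sym (loop-unique m E connected i (punchIn i j) (loop i bar-i) (loop (punchIn i j) bar-j)))
    where
    others : Fin m → Bool
    others j = isBar (ts (punchIn i j))
    other-bars-odd : sum others ≡ true
    other-bars-odd = begin
      sum others                                                       ≡⟨ not-involutive (sum others) ⟨
      true xor (true xor sum others)                                   ≡⟨ cong (λ b → true xor (b xor sum others)) bar-i ⟨
      true xor (isBar (ts i) xor sum others)                           ≡⟨ cong (true xor_) (sum-remove {i = i} (λ i → isBar (ts i))) ⟨
      true xor sum (λ i → isBar (ts i))                                ≡⟨ cong (true xor_) bars-even ⟩
      true ∎
    j : Fin m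
    j = proj₁ (sum-true⇒nonzero others other-bars-odd)
    bar-j : isBar (ts (punchIn i j)) ≡ true
    bar-j = proj₂ (sum-true⇒nonzero others other-bars-odd)

erase-signs : ∀ {m} (ρ : SPerm (suc m)) → sum (sign ρ) ≡ false →
              ∀ τs → Factorization ρ τs → PositiveFactorization (plus ρ) (plusAll τs)
erase-signs ρ even τs fact@(transp , prod , gen) =
    lookup⁻ (λ i → subst IsBTransposition (sym (lookup-map i plus τs))
                         (plus-transposition (lookup⁺ transp i) (no-bars ρ even τs fact i)))
  , trans (plusAll-prodB τs) (cong plus prod)
  , subst Generates (sym (plusAll-absP τs)) gen
  , lookup⁻ (λ i → subst (λ σ → σ ≡ plus σ) (sym (lookup-map i plus τs)) (plus-idempotent (lookup τs i)))

-- Part (ii) in general: a factorization σs of ρ⁺ into positive transpositions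
-- ((a_i b_i)) lifts to a factorization of ρ exactly by the factors ((a_i ±b_i))
-- whose sign vector u solves ∂ u = sign ρ in the trajectory graph of σs; there
-- are exactly two such u.
module Lifts {m} (ρ : SPerm (suc m)) (even : sum (sign ρ) ≡ false)
    (σs : Vec (SPerm (suc m)) (suc m)) (fact : PositiveFactorization (plus ρ) σs) where

  transp : All IsBTransposition σs
  transp = proj₁ fact

  prod : prodB σs ≡ plus ρ
  prod = proj₁ (proj₂ fact)

  gen : Generates (map absP σs)
  gen = proj₁ (proj₂ (proj₂ fact))

  positive : All (λ σ → σ ≡ plus σ) σs
  positive = proj₂ (proj₂ (proj₂ fact))

  shape : ∀ i → Σ (Edge (suc m)) λ e → proj₁ e ≢ proj₂ e × lookup σs i ≡ signedSwap (proj₁ e) (proj₂ e) false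
  shape i = positive-transposition (lookup⁺ transp i) (lookup⁺ positive i)

  G : Graph (suc m) (suc m)
  G i = proj₁ (shape i)

  a b : Fin (suc m) → Fin (suc m)
  a i = proj₁ (G i)
  b i = proj₂ (G i)

  a≢b : ∀ i → a i ≢ b i
  a≢b i = proj₁ (proj₂ (shape i))

  σ-shape : ∀ i → lookup σs i ≡ signedSwap (a i) (b i) false
  σ-shape i = proj₂ (proj₂ (shape i))

  swaps : SwapBase σs G
  swaps i k = trans (cong (λ σ → base σ k) (σ-shape i)) (dswap-base (a i) false (b i) false k)

  E : Graph (suc m) (suc m)
  E = trajectory σs G

  open TwoSolutions (twoSolutions m E (generates⇒connected σs G swaps gen) (sign ρ) even)

  lift : (Fin (suc m) → Bool) → Vec (SPerm (suc m)) (suc m)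
  lift u = tabulate (λ i → signedSwap (a i) (b i) (u i))

  lift-lookup : ∀ u i → lookup (lift u) i ≡ signedSwap (a i) (b i) (u i)
  lift-lookup u = lookup∘tabulate (λ i → signedSwap (a i) (b i) (u i))

  lift-cong : ∀ {u v} → u ≗ v → lift u ≡ lift v
  lift-cong u≗v = tabulate-cong (λ i → cong (signedSwap (a i) (b i)) (u≗v i))

  lift-base : ∀ u → SameBase (lift u) σs
  lift-base u i k = trans (cong (λ σ → base σ k) (lift-lookup u i))
                          (trans (dswap-base (a i) false (b i) (u i) k) (sym (swaps i k)))

  lift-sign : ∀ u i → sign (lookup (lift u) i) ≗ λ z → u i ∧ incident (G i) z
  lift-sign u i z = trans (cong (λ σ → sign σ z) (lift-lookup u i)) (dswap-sign (a i) false (b i) (u i) (a≢b i) z)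

  lift-sign-a : ∀ u i → sign (lookup (lift u) i) (a i) ≡ u i
  lift-sign-a u i = trans (lift-sign u i (a i))
                          (trans (cong₂ (λ d d′ → u i ∧ (d xor d′)) (δ-refl (a i)) (δ-≢ (a≢b i))) (∧-identityʳ (u i)))

  lift-signProd : ∀ u → signProd (lift u) ≗ ∂ E u
  lift-signProd u = signProd-∂ (lift u) σs G u (lift-base u) swaps (lift-sign u)

  lift-factorization : ∀ u → ∂ E u ≗ sign ρ → Factorization ρ (lift u)
  lift-factorization u solves =
      lookup⁻ (λ i → subst IsBTransposition (sym (lift-lookup u i)) (signedSwap-transposition (u i) (a≢b i)))
    , signed-ext (λ x → trans (baseProd-cong (lift u) σs (lift-base u) x)
                              (trans (cong (λ σ → base σ x) prod) (plus-base ρ x)))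
                 (λ x → trans (lift-signProd u x) (solves x))
    , subst Generates (sym same-absP) gen
    where
    same-absP : map absP (lift u) ≡ map absP σs
    same-absP = vec-ext (λ i → trans (lookup-map i absP (lift u))
                                     (trans (absP-cong (lift-base u i)) (sym (lookup-map i absP σs))))

  lift-erases : ∀ u → plusAll (lift u) ≡ σs
  lift-erases u = vec-ext (λ i → begin
    lookup (plusAll (lift u)) i                ≡⟨ lookup-map i plus (lift u) ⟩
    plus (lookup (lift u) i)                   ≡⟨ cong plus (lift-lookup u i) ⟩
    plus (signedSwap (a i) (b i) (u i))        ≡⟨ plus-dswap (a i) false (b i) (u i) (a≢b i) ⟩
    signedSwap (a i) (b i) false               ≡⟨ σ-shape i ⟨
    lookup σs i                                ∎)

  is-lift : ∀ τs → Factorization ρ τs → plusAll τs ≡ σs → τs ≡ lift (λ i → sign (lookup τs i) (a i))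
  is-lift τs (transp′ , _ , _) erases =
    vec-ext (λ i → trans (lifts-of-positive (a≢b i) (lookup⁺ transp′ i) (erased i))
                         (sym (lift-lookup (λ i → sign (lookup τs i) (a i)) i)))
    where
    erased : ∀ i → plus (lookup τs i) ≡ signedSwap (a i) (b i) false
    erased i = trans (sym (lookup-map i plus τs)) (trans (cong (λ v → lookup v i) erases) (σ-shape i))

  u₁ : Fin (suc m) → Bool
  u₁ i = u₀ i xor c i

  preimages : Σ (Vec (SPerm (suc m)) (suc m)) λ τ₁ → Σ (Vec (SPerm (suc m)) (suc m)) λ τ₂ →
              τ₁ ≢ τ₂ × Factorization ρ τ₁ × Factorization ρ τ₂ × plusAll τ₁ ≡ σs × plusAll τ₂ ≡ σs
              × ((τ : Vec (SPerm (suc m)) (suc m)) → Factorization ρ τ → plusAll τ ≡ σs → τ ≡ τ₁ ⊎ τ ≡ τ₂)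
  preimages = lift u₀ , lift u₁ , distinct
            , lift-factorization u₀ u₀-solves , lift-factorization u₁ (add-cycle E u₀ c u₀-solves c-cycle)
            , lift-erases u₀ , lift-erases u₁ , only
    where
    distinct : lift u₀ ≢ lift u₁
    distinct same = flip-differs (u₀ i₀) (begin
      u₀ i₀                                       ≡⟨ lift-sign-a u₀ i₀ ⟨
      sign (lookup (lift u₀) i₀) (a i₀)           ≡⟨ cong (λ τs → sign (lookup τs i₀) (a i₀)) same ⟩
      sign (lookup (lift u₁) i₀) (a i₀)           ≡⟨ lift-sign-a u₁ i₀ ⟩
      u₀ i₀ xor c i₀                              ≡⟨ cong (u₀ i₀ xor_) c-i₀ ⟩
      u₀ i₀ xor true                              ∎)
      where
      flip-differs : ∀ x → x ≢ x xor true
      flip-differs true  ()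
      flip-differs false ()
    only : ∀ τs → Factorization ρ τs → plusAll τs ≡ σs → τs ≡ lift u₀ ⊎ τs ≡ lift u₁
    only τs fact@(_ , prod′ , _) erases =
      Data.Sum.map (trans τs-lift ∘ lift-cong) (trans τs-lift ∘ lift-cong) (solutions w w-solves)
      where
      w : Fin (suc m) → Bool
      w i = sign (lookup τs i) (a i)
      τs-lift : τs ≡ lift w
      τs-lift = is-lift τs fact erases
      w-solves : ∂ E w ≗ sign ρ
      w-solves x = trans (sym (lift-signProd w x))
                         (trans (cong (λ τs → signProd τs x) (sym τs-lift)) (cong (λ σ → sign σ x) prod′))

lemma3p7 : (p q : ℕ) → p ≥ 1 → q ≥ 1 →
    ((τs : Vec (SPerm (p + q)) (p + q)) → FB p q τs → F+ p q (plusAll τs))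
    × ((σs : Vec (SPerm (p + q)) (p + q)) → F+ p q σs →
        Σ (Vec (SPerm (p + q)) (p + q)) λ τ₁ → Σ (Vec (SPerm (p + q)) (p + q)) λ τ₂ →
          ¬ (τ₁ ≡ τ₂) × FB p q τ₁ × FB p q τ₂ × plusAll τ₁ ≡ σs × plusAll τ₂ ≡ σs
          × ((τ : Vec (SPerm (p + q)) (p + q)) → FB p q τ → plusAll τ ≡ σs → τ ≡ τ₁ ⊎ τ ≡ τ₂))
lemma3p7 (suc p′) (suc q′) _ _ = erase , preimages
  where
  -- FB p q is Factorization γ and F+ p q is PositiveFactorization β, where β = γ⁺.
  open GammaSigns p′ q′ using (p; q; γ-sign-even)
  erase : (τs : Vec (SPerm (p + q)) (p + q)) → FB p q τs → F+ p q (plusAll τs)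
  erase τs fact = subst (λ β → PositiveFactorization β (plusAll τs)) (sym (β≡plusγ p q))
                        (erase-signs (gammaPQ p q) γ-sign-even τs fact)
  preimages : (σs : Vec (SPerm (p + q)) (p + q)) → F+ p q σs →
        Σ (Vec (SPerm (p + q)) (p + q)) λ τ₁ → Σ (Vec (SPerm (p + q)) (p + q)) λ τ₂ →
          ¬ (τ₁ ≡ τ₂) × FB p q τ₁ × FB p q τ₂ × plusAll τ₁ ≡ σs × plusAll τ₂ ≡ σs
          × ((τ : Vec (SPerm (p + q)) (p + q)) → FB p q τ → plusAll τ ≡ σs → τ ≡ τ₁ ⊎ τ ≡ τ₂)
  preimages σs fact = Lifts.preimages (gammaPQ p q) γ-sign-even σs
                        (subst (λ β → PositiveFactorization β σs) (β≡plusγ p q) fact)
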